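{- Let $n\ge 2$, $0<\varepsilon<1/n^4$, let $\mathcal{P}'$ be a deterministic cuts-only primitive protocol with decision tree $T$, and let $v$ be a node of $T$ that is reached with positive probability when the instance is drawn from $\mathcal{D}$. Let $\Pi$ be the set of valid permutations at $v$. Then, conditioned on the execution of $\mathcal{P}'$ reaching $v$, the underlying permutation of the instance drawn from $\mathcal{D}$ is uniformly distributed on $\Pi$.
   Context: The cake is $[0,1]$, with $n$ players $p\in\{1,\dots,n\}$. For $i\in\{1,\dots,n\}$ let $X_i=\{\,i/(n+1)+k\varepsilon : k=1,\dots,n\,\}$, and call $i/(n+1)+k\varepsilon$ the $k$-th point of $X_i$. A WS instance is specified by points $x_{p,i}\in X_i$ ($p,i\in\{1,\dots,n\}$) such that for each $i$ the map $p\mapsto x_{p,i}$ is a bijection from $\{1,\dots,n\}$ onto $X_i$. In this instance, player $p$'s measure $\mu_p$ is the measure on $[0,1]$ that puts mass $1/(n+1)$ uniformly on $[0,\varepsilon/2]$ and, for each $i\in\{1,\dots,n\}$, mass $i/(n^2+n)$ uniformly on $[x_{p,i}-\varepsilon/2,\,x_{p,i}]$ and mass $(n-i)/(n^2+n)$ uniformly on $[x_{p,i},\,x_{p,i}+\varepsilon/2]$, and no other mass; the $i/n$-point of $p$ (infimum of $x$ with $\mu_p([0,x])=i/n$) is then $x_{p,i}$. The query $\mathrm{Cut}(p,\alpha)$ returns the $\alpha$-point of $p$. A deterministic protocol issues queries adaptively and terminates by assigning each player a single interval; it is primitive if all its Cut queries are of the form $\mathrm{Cut}(p,i/n)$, $i\in\{1,\dots,n\}$,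 and cuts-only if it makes no evaluation queries. Its decision tree $T$ has internal nodes labeled by the next query $\mathrm{Cut}(p,i/n)$, an outgoing edge for each possible answer (a point of $X_i$) leading to the next state, and leaves labeled by the final allocation; running the protocol on an instance follows a root-to-leaf path. For a permutation $\pi$ of $\{1,\dots,n\}$, let $\mathcal{J}_\pi$ be the set of WS instances such that for all $p,i$: if $\pi(p)=i$ then $x_{p,i}$ is the $i$-th point of $X_i$; if $\pi(p)<i$ then $x_{p,i}$ is one of the first $i-1$ points of $X_i$; if $\pi(p)>i$ then $x_{p,i}$ is one of the last $n-i$ points. Let $\mathcal{J}=\bigcup_\pi\mathcal{J}_\pi$; each instance lies in exactly one $\mathcal{J}_\pi$, and $\pi$ is called its underlying permutation. $\mathcal{D}$ is the uniform distribution on $\mathcal{J}$. A permutation $\pi$ is valid at node $v$ if some instance in $\mathcal{J}_\pi$ is consistent with all query answers on the path from the root to $v$. -}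

module Defs where

open import Data.Nat as ℕ using (ℕ; zero; suc)
open import Data.Fin as Fin using (Fin; zero; suc; _<_)
open import Data.Fin.Properties using (all?; any?; _≟_; _<?_)
open import Data.List using (List; []; _∷_; [_]; map; concatMap; filter; length; allFin)
open import Data.List.Relation.Unary.Any as Any using (Any)
open import Data.Product using (Σ; _×_; _,_; ∃)
open import Data.Unit using (⊤; tt)
open import Relation.Binary.PropositionalEquality using (_≡_)
open import Relation.Nullary using (Dec; yes; no)
open import Relation.Nullary.Decidable using (_×-dec_; _→-dec_)
open import Data.Vec.Functional using () renaming (_∷_ to _∷ᶠ_)

allFuns : ∀ {A : Set} (n : ℕ) → List A → List (Fin n → A)
allFuns zero    xs = [ (λ ()) ]
allFuns (suc n) xs = concatMap (λ a → map (λ f → a ∷ᶠ f) (allFuns n xs)) xs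

count : ∀ {A : Set} {P : A → Set} → ((a : A) → Dec (P a)) → List A → ℕ
count P? xs = length (filter P? xs)

-- Indices are 0-based: player p : Fin n stands for p+1, index i : Fin n
-- stands for i+1 (the query Cut(p,(i+1)/n)), and point k : Fin n stands
-- for the (k+1)-th point of X_{i+1}.

IsPerm : ∀ {n} → (Fin n → Fin n) → Set
IsPerm {n} π = (∀ p q → π p ≡ π q → p ≡ q) × (∀ i → ∃ λ p → π p ≡ i)

IsPerm? : ∀ {n} (π : Fin n → Fin n) → Dec (IsPerm π)
IsPerm? π = all? (λ p → all? (λ q → (π p ≟ π q) →-dec (p ≟ q)))
       ×-dec all? (λ i → any? (λ p → π p ≟ i))

perms : (n : ℕ) → List (Fin n → Fin n)
perms n = filter IsPerm? (allFuns n (allFin n))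

-- A WS instance, abstracted by its combinatorial data:
-- x p i = k  means  x_{p,i} is the k-th point of X_i.
-- (Given ε, the instance, i.e. the measures μ_p, is determined by this.)
Matrix : ℕ → Set
Matrix n = Fin n → Fin n → Fin n

ColBij : ∀ {n} → Matrix n → Set
ColBij {n} x = ∀ i → (∀ p q → x p i ≡ x q i → p ≡ q) × (∀ k → ∃ λ p → x p i ≡ k)

ColBij? : ∀ {n} (x : Matrix n) → Dec (ColBij x)
ColBij? x = all? (λ i → all? (λ p → all? (λ q → (x p i ≟ x q i) →-dec (p ≟ q)))
                    ×-dec all? (λ k → any? (λ p → x p i ≟ k)))

allMatrices : (n : ℕ) → List (Matrix n)
allMatrices n = allFuns n (allFuns n (allFin n))

instances : (n : ℕ) → List (Matrix n)
instances n = filter ColBij? (allMatrices n)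

Cond : ∀ {n} → Fin n → Fin n → Fin n → Set
Cond a i k = (a ≡ i → k ≡ i) × (a < i → k < i) × (i < a → i < k)

Cond? : ∀ {n} (a i k : Fin n) → Dec (Cond a i k)
Cond? a i k = ((a ≟ i) →-dec (k ≟ i)) ×-dec ((a <? i) →-dec (k <? i)) ×-dec ((i <? a) →-dec (i <? k))

InJπ : ∀ {n} → (Fin n → Fin n) → Matrix n → Set
InJπ π x = ColBij x × (∀ p i → Cond (π p) i (x p i))

InJπ? : ∀ {n} (π : Fin n → Fin n) (x : Matrix n) → Dec (InJπ π x)
InJπ? π x = ColBij? x ×-dec all? (λ p → all? (λ i → Cond? (π p) i (x p i)))

InJ : ∀ {n} → Matrix n → Set
InJ {n} x = Any (λ π → InJπ π x) (perms n)

InJ? : ∀ {n} (x : Matrix n) → Dec (InJ x)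
InJ? {n} x = Any.any? (λ π → InJπ? π x) (perms n)

-- Decision tree of a deterministic cuts-only primitive protocol:
-- internal node = query Cut(p,(i+1)/n), with one child per possible answer
-- (a point of X_{i+1}); leaves carry the final allocation (of type L).
data Tree (n : ℕ) (L : Set) : Set where
  leaf  : L → Tree n L
  query : (p i : Fin n) → (Fin n → Tree n L) → Tree n L

data Node {n : ℕ} {L : Set} : Tree n L → Set where
  here : ∀ {T} → Node T
  down : ∀ {p i f} (k : Fin n) → Node (f k) → Node (query p i f)

-- x is consistent with all query answers on the path to v
-- (equivalently, running the protocol on x reaches v)
Reaches : ∀ {n L} {T : Tree n L} → Matrix n → Node T → Set
Reaches x here = ⊤
Reaches x (down {p = p} {i = i} k v) = (x p i ≡ k) × Reaches x v

Reaches? : ∀ {n L} {T : Tree n L} (x : Matrix n) (v : Node T) → Dec (Reaches x v)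
Reaches? x here = yes tt
Reaches? x (down {p = p} {i = i} k v) = (x p i ≟ k) ×-dec Reaches? x v

Valid : ∀ {n L} {T : Tree n L} → (Fin n → Fin n) → Node T → Set
Valid {n} π v = Σ (Matrix n) λ x → InJπ π x × Reaches x v

validPerms : ∀ {n L} {T : Tree n L} → Node T → List (Fin n → Fin n)
validPerms {n} v = filter (λ π → Any.any? (λ x → InJπ? π x ×-dec Reaches? x v) (allMatrices n)) (perms n)

-- |J ∩ {reaches v}|  (numerator of Pr_D[reach v], times |J|)
countReach : ∀ {n L} {T : Tree n L} → Node T → ℕ
countReach {n} v = count (λ x → InJ? x ×-dec Reaches? x v) (allMatrices n)

countReachπ : ∀ {n L} {T : Tree n L} → (Fin n → Fin n) → Node T → ℕ
countReachπ {n} π v = count (λ x → InJπ? π x ×-dec Reaches? x v) (allMatrices n)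

{-# OPTIONS --safe #-}
-- Every instance of J lies in exactly one J_π, so the instances reaching v
-- split as a disjoint union over π of those in J_π.  Given two permutations
-- π, π' valid at v, witnessed by x₀ ∈ J_π and y₀ ∈ J_π', permute the players
-- column by column so that x₀ becomes y₀.  This relabelling is injective, it
-- fixes every entry queried on the way to v (there x₀ and y₀ agree), and it
-- maps J_π into J_π' because membership in J_π only asks each entry x_{p,i}
-- to lie on the same side of i as π(p).  Hence all valid permutations are
-- realised by equally many instances reaching v, and the others by none.
module Submission where

open import Defs
open import Data.Nat using (ℕ; _≤_; _<_; _*_; _^_)
open import Data.Fin using (Fin)
open import Data.List using (length)
open import Data.Integer using (+_)
open import Data.Rational using (ℚ; 0ℚ; 1ℚ; _÷_; _/_)
open import Relation.Binary.PropositionalEquality using (_≡_)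
import Data.Rational as Q

open import Level using (0ℓ)
open import Function using (_∘_; _⇔_; mk⇔; Equivalence)
open import Data.Nat using (zero; suc; _+_)
open import Data.Nat.Properties using (+-suc; *-comm; ≤-antisym; module ≤-Reasoning)
open import Data.Nat.ListAction using (sum)
open import Data.Fin using (zero; suc)
open import Data.Fin.Properties using (<-cmp; <-irrefl; injective⇒≤)
open import Data.Product using (_×_; _,_; proj₁; proj₂)
open import Data.Sum using (_⊎_; inj₁; inj₂; [_,_]′)
open import Data.Empty using (⊥-elim)
open import Data.Unit using (tt)
open import Data.List using (List; []; _∷_; _++_; map; filter; lookup; concatMap; cartesianProductWith)
open import Data.List.Properties using (filter-none; length-map)
open import Data.List.Relation.Unary.All as All using (All; []; _∷_)
open import Data.List.Relation.Unary.All.Properties using (All¬⇒¬Any; ¬Any⇒All¬; all-filter) renaming (map⁺ to All-map⁺)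
open import Data.List.Relation.Unary.Any as Any using (Any; here; there)
open import Data.List.Relation.Unary.AllPairs as AllPairs using (AllPairs; []; _∷_)
open import Data.List.Relation.Unary.Unique.Setoid using (Unique)
import Data.List.Relation.Unary.Unique.Setoid.Properties as Unique
open import Data.List.Relation.Unary.Unique.Propositional.Properties using (allFin⁺)
open import Data.List.Relation.Unary.Enumerates.Setoid using (IsEnumeration)
import Data.List.Membership.Setoid as Membership
open import Data.List.Membership.Setoid.Properties using (∈-filter⁺; ∈-resp-≈; index-injective; ∈-cartesianProductWith⁺)
open import Data.List.Membership.Propositional.Properties using (∈-allFin) renaming (∈-lookup to ∈ₚ-lookup)
import Data.Vec.Functional.Relation.Binary.Pointwise.Properties as Pointwise
open import Data.Vec.Functional using () renaming (_∷_ to _∷ᶠ_)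
open import Relation.Nullary using (¬_; yes; no; _×-dec_; contradiction)
open import Relation.Unary using (Decidable)
open import Relation.Binary using (Setoid; tri<; tri≈; tri>)
open import Relation.Binary.Definitions using (_Respects_)
open import Relation.Binary.PropositionalEquality using (refl; sym; trans; cong; cong₂; subst; _≗_; setoid; module ≡-Reasoning)

module _ {A : Set} where

  count-none : {P : A → Set} (P? : Decidable P) {xs : List A} → All (¬_ ∘ P) xs → count P? xs ≡ 0
  count-none P? none = cong length (filter-none P? none)

  count-⊎ : {P Q R : A → Set} (P? : Decidable P) (Q? : Decidable Q) (R? : Decidable R) →
    (∀ {a} → P a ⇔ (Q a ⊎ R a)) → (∀ {a} → Q a → ¬ R a) →
    ∀ xs → count P? xs ≡ count Q? xs + count R? xs
  count-⊎ P? Q? R? P⇔Q⊎R Q∩R=∅ [] = refl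
  count-⊎ P? Q? R? P⇔Q⊎R Q∩R=∅ (x ∷ xs)
    with ih ← count-⊎ P? Q? R? P⇔Q⊎R Q∩R=∅ xs | P? x | Q? x | R? x
  ... | yes _ | yes q | yes r = contradiction r (Q∩R=∅ q)
  ... | yes _ | yes _ | no _  = cong suc ih
  ... | yes _ | no _  | yes _ = trans (cong suc ih) (sym (+-suc _ _))
  ... | yes p | no ¬q | no ¬r = ⊥-elim ([ ¬q , ¬r ]′ (Equivalence.to P⇔Q⊎R p))
  ... | no ¬p | yes q | _     = contradiction (Equivalence.from P⇔Q⊎R (inj₁ q)) ¬p
  ... | no ¬p | no _  | yes r = contradiction (Equivalence.from P⇔Q⊎R (inj₂ r)) ¬p
  ... | no _  | no _  | no _  = ih

  sum-map-indicator : {V : A → Set} (V? : Decidable V) (c : A → ℕ) {k : ℕ} →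
    (∀ {a} → ¬ V a → c a ≡ 0) → (∀ {a} → V a → c a ≡ k) →
    ∀ xs → sum (map c xs) ≡ count V? xs * k
  sum-map-indicator V? c off on [] = refl
  sum-map-indicator V? c off on (x ∷ xs) with V? x
  ... | yes Vx = cong₂ _+_ (on Vx) (sum-map-indicator V? c off on xs)
  ... | no ¬Vx = cong₂ _+_ (off ¬Vx) (sum-map-indicator V? c off on xs)

module _ {A B : Set} {Q : B → A → Set} {R : A → Set}
         (Q? : ∀ b → Decidable (Q b)) (R? : Decidable R) where

  count-Any-disjoint : (bs : List B) → AllPairs (λ b b' → ∀ {a} → Q b a → ¬ Q b' a) bs →
    ∀ xs → count (λ a → Any.any? (λ b → Q? b a) bs ×-dec R? a) xs
         ≡ sum (map (λ b → count (λ a → Q? b a ×-dec R? a) xs) bs)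
  count-Any-disjoint [] _ xs = count-none _ (All.universal (λ _ ()) xs)
  count-Any-disjoint (b ∷ bs) (b#bs ∷ bs-disjoint) xs =
    trans (count-⊎ _ (λ a → Q? b a ×-dec R? a) _ (mk⇔ split join) disjoint xs)
          (cong₂ _+_ refl (count-Any-disjoint bs bs-disjoint xs))
    where
    split : ∀ {a} → Any (λ b → Q b a) (b ∷ bs) × R a → (Q b a × R a) ⊎ (Any (λ b → Q b a) bs × R a)
    split (here q , r) = inj₁ (q , r)
    split (there q , r) = inj₂ (q , r)
    join : ∀ {a} → (Q b a × R a) ⊎ (Any (λ b → Q b a) bs × R a) → Any (λ b → Q b a) (b ∷ bs) × R a
    join (inj₁ (q , r)) = here q , r
    join (inj₂ (q , r)) = there q , r
    disjoint : ∀ {a} → Q b a × R a → ¬ (Any (λ b → Q b a) bs × R a)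
    disjoint (q , _) (q' , _) = All¬⇒¬Any (All.map (λ b#b' → b#b' q) b#bs) q'

module _ {c ℓ} (S : Setoid c ℓ) where
  open Setoid S using (_≈_) renaming (sym to ≈-sym)
  open Membership S using (_∈_)
  open import Data.List.Relation.Unary.Unique.Setoid S using () renaming (Unique to Unique[S])

  Unique⇒lookup-injective : ∀ {xs} → Unique[S] xs → ∀ {i j} → lookup xs i ≈ lookup xs j → i ≡ j
  Unique⇒lookup-injective (_ ∷ _)     {zero}  {zero}  _   = refl
  Unique⇒lookup-injective (x≉xs ∷ _)  {zero}  {suc j} x≈  = contradiction x≈ (All.lookup x≉xs (∈ₚ-lookup j))
  Unique⇒lookup-injective (x≉xs ∷ _)  {suc i} {zero}  ≈x  = contradiction (≈-sym ≈x) (All.lookup x≉xs (∈ₚ-lookup i))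
  Unique⇒lookup-injective (_ ∷ xs!)   {suc i} {suc j} eq  = cong suc (Unique⇒lookup-injective xs! eq)

  Unique⇒length≤ : ∀ {xs ys} → Unique[S] xs → All (_∈ ys) xs → length xs ≤ length ys
  Unique⇒length≤ {xs} {ys} xs! xs⊆ys =
    injective⇒≤ {f = Any.index ∘ position}
      (λ eq → Unique⇒lookup-injective xs! (index-injective S (position _) (position _) eq))
    where
    position : ∀ i → lookup xs i ∈ ys
    position i = All.lookup xs⊆ys (∈ₚ-lookup i)

module _ {ℓ₁ ℓ₂} (S : Setoid 0ℓ ℓ₁) (T : Setoid 0ℓ ℓ₂) where
  open Setoid S using () renaming (Carrier to A; _≈_ to _≈₁_)
  open Setoid T using () renaming (Carrier to B; _≈_ to _≈₂_)
  open Membership T using (_∈_)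

  count-mono-injection : {P : A → Set} {Q : B → Set} (P? : Decidable P) (Q? : Decidable Q) →
    Q Respects _≈₂_ → (f : A → B) → (∀ {x y} → f x ≈₂ f y → x ≈₁ y) → (∀ {x} → P x → Q (f x)) →
    ∀ {xs ys} → Unique S xs → IsEnumeration T ys → count P? xs ≤ count Q? ys
  count-mono-injection P? Q? Q-resp f f-injective P⇒Q∘f {xs} {ys} xs! ys-complete = begin
    count P? xs                   ≡⟨ length-map f (filter P? xs) ⟨
    length (map f (filter P? xs)) ≤⟨ Unique⇒length≤ T (Unique.map⁺ S T f-injective (Unique.filter⁺ S P? xs!)) image⊆ ⟩
    count Q? ys                   ∎
    where
    open ≤-Reasoning
    image⊆ : All (_∈ filter Q? ys) (map f (filter P? xs))
    image⊆ = All-map⁺ (All.map (λ {x} Px → ∈-filter⁺ T Q? Q-resp (ys-complete (f x)) (P⇒Q∘f Px))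
                               (all-filter P? xs))

cartesianProductWith≡concatMap : {A B C : Set} (f : A → B → C) (xs : List A) (ys : List B) →
  cartesianProductWith f xs ys ≡ concatMap (λ x → map (f x) ys) xs
cartesianProductWith≡concatMap f []       ys = refl
cartesianProductWith≡concatMap f (x ∷ xs) ys = cong (map (f x) ys ++_) (cartesianProductWith≡concatMap f xs ys)

module _ {ℓ} (S : Setoid 0ℓ ℓ) where
  open Setoid S using () renaming (refl to ≈-refl)

  allFuns-unique : ∀ n {xs} → Unique S xs → Unique (Pointwise.setoid S n) (allFuns n xs)
  allFuns-unique zero    _   = [] ∷ []
  allFuns-unique (suc n) {xs} xs! rewrite sym (cartesianProductWith≡concatMap _∷ᶠ_ xs (allFuns n xs)) =
    Unique.cartesianProductWith⁺ S (Pointwise.setoid S n) (Pointwise.setoid S (suc n)) _∷ᶠ_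
      (λ eq → eq zero , eq ∘ suc) xs! (allFuns-unique n xs!)

  allFuns-enumerates : ∀ n {xs} → IsEnumeration S xs → IsEnumeration (Pointwise.setoid S n) (allFuns n xs)
  allFuns-enumerates zero    _ f = here (λ ())
  allFuns-enumerates (suc n) {xs} xs-complete f rewrite sym (cartesianProductWith≡concatMap _∷ᶠ_ xs (allFuns n xs)) =
    ∈-resp-≈ (Pointwise.setoid S (suc n)) (λ { zero → ≈-refl ; (suc i) → ≈-refl })
      (∈-cartesianProductWith⁺ S (Pointwise.setoid S n) (Pointwise.setoid S (suc n))
         (λ { a≈b f≈g zero → a≈b ; a≈b f≈g (suc i) → f≈g i })
         (xs-complete (f zero)) (allFuns-enumerates n xs-complete (f ∘ suc)))

MatrixSetoid : ℕ → Setoid 0ℓ 0ℓ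
MatrixSetoid n = Pointwise.setoid (Pointwise.setoid (setoid (Fin n)) n) n

allMatrices-unique : ∀ n → Unique (MatrixSetoid n) (allMatrices n)
allMatrices-unique n = allFuns-unique (Pointwise.setoid (setoid (Fin n)) n) n (allFuns-unique (setoid (Fin n)) n (allFin⁺ n))

allMatrices-enumerates : ∀ n → IsEnumeration (MatrixSetoid n) (allMatrices n)
allMatrices-enumerates n = allFuns-enumerates (Pointwise.setoid (setoid (Fin n)) n) n (allFuns-enumerates (setoid (Fin n)) n ∈-allFin)

perms-unique : ∀ n → Unique (Pointwise.setoid (setoid (Fin n)) n) (perms n)
perms-unique n = Unique.filter⁺ (Pointwise.setoid (setoid (Fin n)) n) IsPerm? (allFuns-unique (setoid (Fin n)) n (allFin⁺ n))

data Side : Set where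
  below at above : Side

side : ∀ {n} → Fin n → Fin n → Side
side a i with <-cmp a i
... | tri< _ _ _ = below
... | tri≈ _ _ _ = at
... | tri> _ _ _ = above

module _ {n} {a i k : Fin n} where

  Cond⇒side≡ : Cond a i k → side a i ≡ side k i
  Cond⇒side≡ (a≡i⇒k≡i , a<i⇒k<i , i<a⇒i<k) with <-cmp a i | <-cmp k i
  ... | tri< _ _ _   | tri< _ _ _   = refl
  ... | tri< a<i _ _ | tri≈ k≮i _ _ = contradiction (a<i⇒k<i a<i) k≮i
  ... | tri< a<i _ _ | tri> k≮i _ _ = contradiction (a<i⇒k<i a<i) k≮i
  ... | tri≈ _ a≡i _ | tri< _ k≢i _ = contradiction (a≡i⇒k≡i a≡i) k≢i
  ... | tri≈ _ _ _   | tri≈ _ _ _   = refl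
  ... | tri≈ _ a≡i _ | tri> _ k≢i _ = contradiction (a≡i⇒k≡i a≡i) k≢i
  ... | tri> _ _ i<a | tri< _ _ i≮k = contradiction (i<a⇒i<k i<a) i≮k
  ... | tri> _ _ i<a | tri≈ _ _ i≮k = contradiction (i<a⇒i<k i<a) i≮k
  ... | tri> _ _ _   | tri> _ _ _   = refl

  side≡⇒Cond : side a i ≡ side k i → Cond a i k
  side≡⇒Cond same with <-cmp a i | <-cmp k i | same
  ... | tri< _ a≢i i≮a | tri< k<i _ _ | _ =
    (λ a≡i → contradiction a≡i a≢i) , (λ _ → k<i) , (λ i<a → contradiction i<a i≮a)
  ... | tri≈ a≮i _ i≮a | tri≈ _ k≡i _ | _ =
    (λ _ → k≡i) , (λ a<i → contradiction a<i a≮i) , (λ i<a → contradiction i<a i≮a)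
  ... | tri> a≮i a≢i _ | tri> _ _ i<k | _ =
    (λ a≡i → contradiction a≡i a≢i) , (λ a<i → contradiction a<i a≮i) , (λ _ → i<k)
  ... | tri< _ _ _ | tri≈ _ _ _ | ()
  ... | tri< _ _ _ | tri> _ _ _ | ()
  ... | tri≈ _ _ _ | tri< _ _ _ | ()
  ... | tri≈ _ _ _ | tri> _ _ _ | ()
  ... | tri> _ _ _ | tri< _ _ _ | ()
  ... | tri> _ _ _ | tri≈ _ _ _ | ()

Cond-at⇒≡ : ∀ {n} {a i : Fin n} → Cond a i i → a ≡ i
Cond-at⇒≡ {a = a} {i} (_ , a<i⇒i<i , i<a⇒i<i) with <-cmp a i
... | tri< a<i _ _ = contradiction (a<i⇒i<i a<i) (<-irrefl refl)
... | tri≈ _ a≡i _ = a≡i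
... | tri> _ _ i<a = contradiction (i<a⇒i<i i<a) (<-irrefl refl)

InJπ⇒≗ : ∀ {n} {π π' : Fin n → Fin n} {x : Matrix n} → InJπ π x → InJπ π' x → π ≗ π'
InJπ⇒≗ {π = π} {π'} {x} (_ , cond) (_ , cond') p =
  sym (Cond-at⇒≡ (subst (Cond (π' p) (π p)) (proj₁ (cond p (π p)) refl) (cond' p (π p))))

perms-disjoint : ∀ n → AllPairs (λ π π' → ∀ {x} → InJπ π x → ¬ InJπ π' x) (perms n)
perms-disjoint n = AllPairs.map (λ π≉π' {x} x∈Jπ x∈Jπ' → π≉π' (InJπ⇒≗ x∈Jπ x∈Jπ')) (perms-unique n)

module _ {n} {x : Matrix n} (bij : ColBij x) where

  column-injective : ∀ i {p q} → x p i ≡ x q i → p ≡ q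
  column-injective i = proj₁ (bij i) _ _

  preimage : Fin n → Fin n → Fin n
  preimage i k = proj₁ (proj₂ (bij i) k)

  x∘preimage : ∀ i k → x (preimage i k) i ≡ k
  x∘preimage i k = proj₂ (proj₂ (bij i) k)

  preimage∘x : ∀ i p → preimage i (x p i) ≡ p
  preimage∘x i p = column-injective i (x∘preimage i (x p i))

module _ {n : ℕ} where
  open Setoid (MatrixSetoid n) using (_≈_)

  ColBij-resp : ColBij Respects _≈_
  ColBij-resp {x} {y} x≈y bij i =
    (λ p q y-eq → column-injective bij i (trans (x≈y p i) (trans y-eq (sym (x≈y q i))))) ,
    (λ k → preimage bij i k , trans (sym (x≈y _ i)) (x∘preimage bij i k))

  InJπ-resp : ∀ π → InJπ π Respects _≈_
  InJπ-resp π x≈y (bij , cond) = ColBij-resp x≈y bij , λ p i → subst (Cond (π p) i) (x≈y p i) (cond p i)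

  Reaches-resp : ∀ {L} {T : Tree n L} (v : Node T) → (λ x → Reaches x v) Respects _≈_
  Reaches-resp here x≈y tt = tt
  Reaches-resp (down {p = p} {i = i} k v) x≈y (x-eq , x→v) = trans (sym (x≈y p i)) x-eq , Reaches-resp v x≈y x→v

module Relabel {n} {x₀ y₀ : Matrix n} (x₀-bij : ColBij x₀) (y₀-bij : ColBij y₀) where
  open Setoid (MatrixSetoid n) using (_≈_)

  σ : Fin n → Fin n → Fin n
  σ i p = preimage x₀-bij i (y₀ p i)

  σ⁻¹ : Fin n → Fin n → Fin n
  σ⁻¹ i q = preimage y₀-bij i (x₀ q i)

  x₀∘σ : ∀ i p → x₀ (σ i p) i ≡ y₀ p i
  x₀∘σ i p = x∘preimage x₀-bij i (y₀ p i)

  σ∘σ⁻¹ : ∀ i q → σ i (σ⁻¹ i q) ≡ q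
  σ∘σ⁻¹ i q = trans (cong (preimage x₀-bij i) (x∘preimage y₀-bij i (x₀ q i))) (preimage∘x x₀-bij i q)

  σ-injective : ∀ i {p q} → σ i p ≡ σ i q → p ≡ q
  σ-injective i {p} {q} σp≡σq = column-injective y₀-bij i (begin
    y₀ p i        ≡⟨ x₀∘σ i p ⟨
    x₀ (σ i p) i  ≡⟨ cong (λ r → x₀ r i) σp≡σq ⟩
    x₀ (σ i q) i  ≡⟨ x₀∘σ i q ⟩
    y₀ q i        ∎)
    where open ≡-Reasoning

  σ-fixes : ∀ {i p} → x₀ p i ≡ y₀ p i → σ i p ≡ p
  σ-fixes {i} {p} agree = trans (cong (preimage x₀-bij i) (sym agree)) (preimage∘x x₀-bij i p)

  relabel : Matrix n → Matrix n
  relabel x p i = x (σ i p) i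

  relabel-injective : ∀ {x y} → relabel x ≈ relabel y → x ≈ y
  relabel-injective {x} {y} eq q i = subst (λ r → x r i ≡ y r i) (σ∘σ⁻¹ i q) (eq (σ⁻¹ i q) i)

  relabel-ColBij : ∀ {x} → ColBij x → ColBij (relabel x)
  relabel-ColBij {x} bij i =
    (λ p q eq → σ-injective i (column-injective bij i eq)) ,
    (λ k → σ⁻¹ i (preimage bij i k) , trans (cong (λ r → x r i) (σ∘σ⁻¹ i _)) (x∘preimage bij i k))

  relabel-InJπ : ∀ {π π' x} → InJπ π x₀ → InJπ π' y₀ → InJπ π x → InJπ π' (relabel x)
  relabel-InJπ {π} {π'} {x} (_ , cond₀) (_ , cond₁) (bij , cond) = relabel-ColBij bij , λ p i →
    side≡⇒Cond (begin
      side (π' p) i            ≡⟨ Cond⇒side≡ (cond₁ p i) ⟩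
      side (y₀ p i) i          ≡⟨ cong (λ k → side k i) (x₀∘σ i p) ⟨
      side (x₀ (σ i p) i) i    ≡⟨ Cond⇒side≡ (cond₀ (σ i p) i) ⟨
      side (π (σ i p)) i       ≡⟨ Cond⇒side≡ (cond (σ i p) i) ⟩
      side (x (σ i p) i) i     ∎)
    where open ≡-Reasoning

  relabel-Reaches : ∀ {L} {T : Tree n L} (v : Node T) {x} →
    Reaches x₀ v → Reaches y₀ v → Reaches x v → Reaches (relabel x) v
  relabel-Reaches here _ _ _ = tt
  relabel-Reaches (down {p = p} {i = i} k v) {x} (x₀-eq , x₀→v) (y₀-eq , y₀→v) (x-eq , x→v) =
    trans (cong (λ r → x r i) (σ-fixes (trans x₀-eq (sym y₀-eq)))) x-eq ,
    relabel-Reaches v x₀→v y₀→v x→v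

module _ {n L} {T : Tree n L} (v : Node T) where

  countReachπ-mono : ∀ {π π'} → Valid π v → Valid π' v → countReachπ π v ≤ countReachπ π' v
  countReachπ-mono {π} {π'} (x₀ , x₀∈Jπ , x₀→v) (y₀ , y₀∈Jπ' , y₀→v) =
    count-mono-injection (MatrixSetoid n) (MatrixSetoid n) _ _
      (λ x≈y (x∈Jπ' , x→v) → InJπ-resp π' x≈y x∈Jπ' , Reaches-resp v x≈y x→v)
      relabel relabel-injective
      (λ (x∈Jπ , x→v) → relabel-InJπ x₀∈Jπ y₀∈Jπ' x∈Jπ , relabel-Reaches v x₀→v y₀→v x→v)
      (allMatrices-unique n) (allMatrices-enumerates n)
    where open Relabel (proj₁ x₀∈Jπ) (proj₁ y₀∈Jπ')

  countReachπ-valid-≡ : ∀ {π π'} → Valid π v → Valid π' v → countReachπ π v ≡ countReachπ π' v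
  countReachπ-valid-≡ π-valid π'-valid =
    ≤-antisym (countReachπ-mono π-valid π'-valid) (countReachπ-mono π'-valid π-valid)

  countReach≡sum : countReach v ≡ sum (map (λ π → countReachπ π v) (perms n))
  countReach≡sum = count-Any-disjoint InJπ? (λ x → Reaches? x v) (perms n) (perms-disjoint n) (allMatrices n)

lemma5 : (n : ℕ) → 2 ≤ n →
    (ε : ℚ) → 0ℚ Q.< ε → ε Q.* ((+ (n ^ 4)) / 1) Q.< 1ℚ →
    {L : Set} (T : Tree n L) (v : Node T) →
    0 < countReach v →
    (π : Fin n → Fin n) → IsPerm π → Valid π v →
    countReachπ π v * length (validPerms v) ≡ countReach v
lemma5 n _ _ _ _ T v _ π _ π-valid = begin
  countReachπ π v * length (validPerms v)        ≡⟨ *-comm (countReachπ π v) _ ⟩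
  length (validPerms v) * countReachπ π v        ≡⟨ sum-map-indicator _ (λ π' → countReachπ π' v)
                                                      (λ π'-invalid → count-none _ (¬Any⇒All¬ _ π'-invalid))
                                                      (λ π'-valid → countReachπ-valid-≡ v (Any.satisfied π'-valid) π-valid)
                                                      (perms n) ⟨
  sum (map (λ π' → countReachπ π' v) (perms n)) ≡⟨ countReach≡sum v ⟨
  countReach v                                   ∎
  where open ≡-Reasoning
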